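{- Let $G$ be a finite, simple, connected graph, let $r\ge 1$, and let $\Omega$ be a minimum strong geodetic set of $P_r\,\square\, G$. If $r > {\rm diam}(G)\binom{|\Omega|}{2} + |\Omega|$, then ${\rm sg}(P_r\,\square\, G) \geq \lceil 2\sqrt{|V(G)|}\, \rceil$.
   Context: $P_r$ is the path on vertex set $\{1,\dots,r\}$. For a graph $G=(V,E)$ and $S\subseteq V$, for each pair $\{x,y\}\subseteq S$ with $x\neq y$ let $\widetilde{P}(x,y)$ be a selected fixed shortest $x,y$-path, and let $\widetilde{I}(S)=\{\widetilde{P}(x,y): x,y\in S\}$. $S$ is a strong geodetic set if for some such choice of geodesics, every vertex of $G$ lies on some path of $\widetilde{I}(S)$. A minimum strong geodetic set is one of smallest cardinality; this cardinality is the strong geodetic number ${\rm sg}(G)$. The Cartesian product $G\,\square\, H$ has vertex set $V(G)\times V(H)$, with $(g,h)$ adjacent to $(g',h')$ iff either $g=g'$ and $hh'\in E(H)$, or $h=h'$ and $gg'\in E(G)$. ${\rm diam}(G)$ is the maximum distance between vertices of $G$. -}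

module Defs where

open import Data.Nat using (ℕ; zero; suc; _+_; _*_; _≤_; _<_)
open import Data.Fin using (Fin; toℕ)
import Data.Fin as F
open import Data.Product using (Σ; ∃; _×_; _,_)
open import Data.Sum using (_⊎_)
open import Data.List using (List; length; lookup)
open import Data.List.Relation.Unary.Unique.Propositional using (Unique)
open import Relation.Binary.PropositionalEquality using (_≡_)
open import Relation.Nullary using (¬_)

record Graph (V : Set) : Set₁ where
  field
    Adj    : V → V → Set
    sym    : ∀ {x y} → Adj x y → Adj y x
    irrefl : ∀ {x} → ¬ Adj x x
open Graph public

data Walk {V : Set} (G : Graph V) : V → V → ℕ → Set where
  [_]  : (x : V) → Walk G x x 0
  _∷_  : ∀ {x y z k} → Adj G x y → Walk G y z k → Walk G x z (suc k)

data OnWalk {V : Set} {G : Graph V} (v : V) : ∀ {x y k} → Walk G x y k → Set where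
  here-nil  : OnWalk v [ v ]
  here-cons : ∀ {y z k} (e : Adj G v y) (w : Walk G y z k) → OnWalk v (e ∷ w)
  there     : ∀ {x y z k} (e : Adj G x y) {w : Walk G y z k} → OnWalk v w → OnWalk v (e ∷ w)

Connected : {V : Set} → Graph V → Set
Connected {V} G = (x y : V) → ∃ λ k → Walk G x y k

Dist : {V : Set} → Graph V → V → V → ℕ → Set
Dist G x y d = Walk G x y d × (∀ k → Walk G x y k → d ≤ k)

IsDiam : {V : Set} → Graph V → ℕ → Set
IsDiam {V} G D = (∀ x y d → Dist G x y d → d ≤ D)
               × Σ V λ x → Σ V λ y → Dist G x y D

record Geodesic {V : Set} (G : Graph V) (x y : V) : Set where
  field
    len      : ℕ
    walk     : Walk G x y len
    shortest : ∀ k → Walk G x y k → len ≤ k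

-- S (a duplicate-free list) is a strong geodetic set: one geodesic is fixed
-- for each unordered pair {S[i], S[j]} (encoded as i < j), and together they
-- cover every vertex.
StrongGeodetic : {V : Set} → Graph V → List V → Set
StrongGeodetic {V} G S =
  Σ ((i j : Fin (length S)) → i F.< j → Geodesic G (lookup S i) (lookup S j)) λ P →
    (v : V) → Σ (Fin (length S)) λ i → Σ (Fin (length S)) λ j → Σ (i F.< j) λ i<j →
      OnWalk v (Geodesic.walk (P i j i<j))

MinStrongGeodetic : {V : Set} → Graph V → List V → Set
MinStrongGeodetic {V} G Ω =
  Unique Ω × StrongGeodetic G Ω
  × (∀ (S : List V) → Unique S → StrongGeodetic G S → length Ω ≤ length S)

-- Path P_r on vertices Fin r (i.e. 1..r shifted to 0..r-1)
PathGraph : (r : ℕ) → Graph (Fin r)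
PathGraph r = record
  { Adj = λ i j → (toℕ j ≡ suc (toℕ i)) ⊎ (toℕ i ≡ suc (toℕ j))
  ; sym = symP
  ; irrefl = irr }
  where
  open import Data.Sum using (inj₁; inj₂)
  open import Relation.Binary.PropositionalEquality using (sym)
  open import Data.Nat.Properties using (n<1+n; <-irrefl)
  symP : ∀ {i j : Fin r} → (toℕ j ≡ suc (toℕ i)) ⊎ (toℕ i ≡ suc (toℕ j))
       → (toℕ i ≡ suc (toℕ j)) ⊎ (toℕ j ≡ suc (toℕ i))
  symP (inj₁ p) = inj₂ p
  symP (inj₂ p) = inj₁ p
  irr : ∀ {i : Fin r} → ¬ ((toℕ i ≡ suc (toℕ i)) ⊎ (toℕ i ≡ suc (toℕ i)))
  irr {i} (inj₁ p) = <-irrefl p (n<1+n (toℕ i))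
  irr {i} (inj₂ p) = <-irrefl p (n<1+n (toℕ i))

□Adj : {A B : Set} → Graph A → Graph B → A × B → A × B → Set
□Adj G H (g , h) (g' , h') = (g ≡ g' × Adj H h h') ⊎ (h ≡ h' × Adj G g g')

_□_ : {A B : Set} → Graph A → Graph B → Graph (A × B)
_□_ {A} {B} G H = record
  { Adj = □Adj G H
  ; sym = symP
  ; irrefl = irr }
  where
  open import Data.Sum using (inj₁; inj₂)
  import Relation.Binary.PropositionalEquality as Eq
  symP : ∀ {x y : A × B} → □Adj G H x y → □Adj G H y x
  symP {g , h} {g' , h'} (inj₁ (p , a)) = inj₁ (Eq.sym p , Graph.sym H a)
  symP {g , h} {g' , h'} (inj₂ (p , a)) = inj₂ (Eq.sym p , Graph.sym G a)
  irr : ∀ {x : A × B} → ¬ □Adj G H x x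
  irr {g , h} (inj₁ (_ , a)) = Graph.irrefl H a
  irr {g , h} (inj₂ (_ , a)) = Graph.irrefl G a

-- c = ⌈2√n⌉, i.e. c is the least natural number with c ≥ 2√n (⟺ c² ≥ 4n)
IsCeil2Sqrt : ℕ → ℕ → Set
IsCeil2Sqrt n c = (4 * n ≤ c * c) × (∀ k → 4 * n ≤ k * k → c ≤ k)

-- Let k = |Ω|. Each of the C(k,2) fixed geodesics projects onto a geodesic of G, so it makes
-- at most D steps inside layers {p} × V(G); these steps and the k vertices of Ω occupy at most
-- D·C(k,2) + k < r layers, so some layer ℓ is free of them. A geodesic meets such a layer at
-- most once (a return to it could be shortcut inside the layer), and only if its endpoints lie
-- strictly on opposite sides of ℓ. Hence the n vertices of layer ℓ need n ≤ a·b pairs, where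
-- a + b = k count the vertices of Ω below and above ℓ, and 4ab ≤ k² gives ⌈2√n⌉ ≤ k.

module Submission where

open import Defs
open import Data.Nat using (ℕ; zero; suc; _+_; _*_; _∸_; _≤_; _<_; _<?_; ∣_-_∣; z≤n; s≤s)
open import Data.Nat.Properties
open import Data.Nat.Combinatorics using (_C_; nC1≡n; nCk+nC[k+1]≡[n+1]C[k+1])
open import Data.Nat.Solver using (module +-*-Solver)
open import Data.Fin as F using (Fin; toℕ; combine)
import Data.Fin.Properties as FP
open import Data.Product using (Σ; ∃; _×_; _,_; proj₁; proj₂; uncurry)
open import Data.Product.Properties using (,-injective)
import Data.Sum as Sum
open import Data.Sum using (_⊎_; inj₁; inj₂)
open import Data.List using (List; []; _∷_; _++_; length; map; filter; concatMap; allFin; lookup)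
open import Data.List.Properties using (length-++; length-map; length-tabulate)
open import Data.List.Membership.Propositional using (_∈_; _∉_)
open import Data.List.Membership.Propositional.Properties
  using (∈-map⁺; ∈-++⁺ˡ; ∈-++⁺ʳ; ∈-allFin; ∈-filter⁺; ∈-concat⁺′; ∈-lookup)
open import Data.List.Membership.DecPropositional _≟_ using (_∈?_)
import Data.List.Membership.Setoid.Properties as SetoidMembership
open import Data.List.Relation.Unary.Any using (here; there; index)
open import Data.Empty using (⊥-elim)
open import Function using (_∘_; Injective)
open import Relation.Binary.PropositionalEquality as ≡
  using (_≡_; _≢_; refl; cong; cong₂; subst; subst₂; module ≡-Reasoning)
open import Relation.Nullary using (¬_; yes; no; contradiction)
open import Relation.Unary using (Pred; Decidable)
open import Relation.Unary.Properties using (∁?)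
open import Level using (0ℓ)

∣-∣-between : ∀ {m l n} → m ≤ n → ∣ m - l ∣ + ∣ l - n ∣ ≤ ∣ m - n ∣ → m ≤ l × l ≤ n
∣-∣-between {m} {l} {n} m≤n tight = m≤l , l≤n
  where
  m+∣m-n∣≡n : m + ∣ m - n ∣ ≡ n
  m+∣m-n∣≡n = ≡.trans (cong (m +_) (m≤n⇒∣m-n∣≡n∸m m≤n)) (m+[n∸m]≡n m≤n)

  via-l≤n : m + (∣ m - l ∣ + ∣ l - n ∣) ≤ n
  via-l≤n = ≤-trans (+-monoʳ-≤ m tight) (≤-reflexive m+∣m-n∣≡n)

  m≤l : m ≤ l
  m≤l = m+n≤o⇒m≤o m (+-cancelʳ-≤ ∣ l - n ∣ _ _ (begin
    m + ∣ m - l ∣ + ∣ l - n ∣   ≡⟨ +-assoc m _ _ ⟩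
    m + (∣ m - l ∣ + ∣ l - n ∣) ≤⟨ via-l≤n ⟩
    n                           ≤⟨ m≤n+∣n-m∣ n l ⟩
    l + ∣ l - n ∣               ∎))
    where open ≤-Reasoning

  l≤n : l ≤ n
  l≤n = m+n≤o⇒m≤o l (begin
    l + ∣ l - n ∣               ≤⟨ +-monoˡ-≤ ∣ l - n ∣ (m≤n+∣n-m∣ l m) ⟩
    m + ∣ m - l ∣ + ∣ l - n ∣   ≡⟨ +-assoc m _ _ ⟩
    m + (∣ m - l ∣ + ∣ l - n ∣) ≤⟨ via-l≤n ⟩
    n                           ∎)
    where open ≤-Reasoning

∣-∣-strictly-between : ∀ {m l n} → m ≢ l → n ≢ l → ∣ m - l ∣ + ∣ l - n ∣ ≤ ∣ m - n ∣ →
                       (m < l × l < n) ⊎ (n < l × l < m)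
∣-∣-strictly-between {m} {l} {n} m≢l n≢l tight with ≤-total m n
... | inj₁ m≤n = let m≤l , l≤n = ∣-∣-between m≤n tight in
  inj₁ (≤∧≢⇒< m≤l m≢l , ≤∧≢⇒< l≤n (n≢l ∘ ≡.sym))
... | inj₂ n≤m = let n≤l , l≤m = ∣-∣-between n≤m tight′ in
  inj₂ (≤∧≢⇒< n≤l n≢l , ≤∧≢⇒< l≤m (m≢l ∘ ≡.sym))
  where
  tight′ : ∣ n - l ∣ + ∣ l - m ∣ ≤ ∣ n - m ∣
  tight′ = subst₂ _≤_ (≡.trans (+-comm ∣ m - l ∣ ∣ l - n ∣) (cong₂ _+_ (∣-∣-comm l n) (∣-∣-comm m l)))
                      (∣-∣-comm m n) tight

∣n-1+n∣≡1 : ∀ n → ∣ n - suc n ∣ ≡ 1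
∣n-1+n∣≡1 zero    = refl
∣n-1+n∣≡1 (suc n) = ∣n-1+n∣≡1 n

4*[m*n]≤[m+n]*[m+n] : ∀ m n → 4 * (m * n) ≤ (m + n) * (m + n)
4*[m*n]≤[m+n]*[m+n] m n = Sum.[ ordered m n , swapped ]′ (≤-total m n)
  where
  open +-*-Solver
  gap : ∀ a t → 4 * (a * (a + t)) ≤ (a + (a + t)) * (a + (a + t))
  gap a t = ≤-trans (m≤m+n _ (t * t)) (≤-reflexive (solve 2
    (λ a t → con 4 :* (a :* (a :+ t)) :+ t :* t := (a :+ (a :+ t)) :* (a :+ (a :+ t))) refl a t))

  ordered : ∀ a b → a ≤ b → 4 * (a * b) ≤ (a + b) * (a + b)
  ordered a b a≤b = subst (λ b → 4 * (a * b) ≤ (a + b) * (a + b)) (m+[n∸m]≡n a≤b) (gap a (b ∸ a))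

  swapped : n ≤ m → 4 * (m * n) ≤ (m + n) * (m + n)
  swapped n≤m = subst₂ _≤_ (cong (4 *_) (*-comm n m)) (cong₂ _*_ (+-comm n m) (+-comm n m)) (ordered n m n≤m)

∃-toℕ∉ : ∀ {r} (L : List ℕ) → length L < r → ∃ λ (ℓ : Fin r) → toℕ ℓ ∉ L
∃-toℕ∉ {r} L |L|<r = FP.¬∀⟶∃¬ r _ (λ ℓ → toℕ ℓ ∈? L) all∈⇒r≤|L|
  where
  all∈⇒r≤|L| : ¬ (∀ (ℓ : Fin r) → toℕ ℓ ∈ L)
  all∈⇒r≤|L| ∈L = <⇒≱ |L|<r (FP.injective⇒≤ index∘∈L-injective)
    where
    index∘∈L-injective : Injective _≡_ _≡_ (index ∘ ∈L)
    index∘∈L-injective {a} {b} eq =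
      FP.toℕ-injective (SetoidMembership.index-injective (≡.setoid ℕ) (∈L a) (∈L b) eq)

length-concatMap≤ : ∀ {A B : Set} (f : A → List B) {D} → (∀ a → length (f a) ≤ D) →
                    ∀ xs → length (concatMap f xs) ≤ D * length xs
length-concatMap≤ f bound []           = z≤n
length-concatMap≤ f {D} bound (x ∷ xs) = begin
  length (f x ++ concatMap f xs)          ≡⟨ length-++ (f x) ⟩
  length (f x) + length (concatMap f xs)  ≤⟨ +-mono-≤ (bound x) (length-concatMap≤ f bound xs) ⟩
  D + D * length xs                       ≡⟨ *-suc D (length xs) ⟨
  D * suc (length xs)                     ∎
  where open ≤-Reasoning

length-filter+length-filter-∁ : ∀ {A : Set} {P : Pred A 0ℓ} (P? : Decidable P) xs →
                                length (filter P? xs) + length (filter (∁? P?) xs) ≡ length xs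
length-filter+length-filter-∁ P? []       = refl
length-filter+length-filter-∁ P? (x ∷ xs) with P? x
... | yes _ = cong suc (length-filter+length-filter-∁ P? xs)
... | no  _ = ≡.trans (+-suc _ _) (cong suc (length-filter+length-filter-∁ P? xs))

4*≤-square-if-injective-across : ∀ {n k} {P : Pred (Fin k) 0ℓ} (P? : Decidable P) →
  (f : Fin n → Fin k × Fin k) → (∀ v → P (proj₁ (f v)) × ¬ P (proj₂ (f v))) →
  Injective _≡_ _≡_ f → 4 * n ≤ k * k
4*≤-square-if-injective-across {n} {k} P? f across f-injective = begin
  4 * n                       ≤⟨ *-monoʳ-≤ 4 (FP.injective⇒≤ g-injective) ⟩
  4 * (|P| * |∁P|)            ≤⟨ 4*[m*n]≤[m+n]*[m+n] |P| |∁P| ⟩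
  (|P| + |∁P|) * (|P| + |∁P|) ≡⟨ cong₂ _*_ |P|+|∁P|≡k |P|+|∁P|≡k ⟩
  k * k                       ∎
  where
  open ≤-Reasoning
  inside outside : List (Fin k)
  inside  = filter P? (allFin k)
  outside = filter (∁? P?) (allFin k)

  |P| |∁P| : ℕ
  |P|  = length inside
  |∁P| = length outside

  |P|+|∁P|≡k : |P| + |∁P| ≡ k
  |P|+|∁P|≡k = ≡.trans (length-filter+length-filter-∁ P? (allFin k)) (length-tabulate {n = k} (λ i → i))

  ∈inside : ∀ v → proj₁ (f v) ∈ inside
  ∈inside v = ∈-filter⁺ P? (∈-allFin _) (proj₁ (across v))

  ∈outside : ∀ v → proj₂ (f v) ∈ outside
  ∈outside v = ∈-filter⁺ (∁? P?) (∈-allFin _) (proj₂ (across v))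

  g : Fin n → Fin (|P| * |∁P|)
  g v = combine (index (∈inside v)) (index (∈outside v))

  g-injective : Injective _≡_ _≡_ g
  g-injective {v} {w} eq = f-injective (cong₂ _,_
    (SetoidMembership.index-injective (≡.setoid (Fin k)) (∈inside v) (∈inside w) (proj₁ indices≡))
    (SetoidMembership.index-injective (≡.setoid (Fin k)) (∈outside v) (∈outside w) (proj₂ indices≡)))
    where
    indices≡ : index (∈inside v) ≡ index (∈inside w) × index (∈outside v) ≡ index (∈outside w)
    indices≡ = FP.combine-injective (index (∈inside v)) (index (∈outside v))
                                    (index (∈inside w)) (index (∈outside w)) eq

IncreasingPair : ℕ → Set
IncreasingPair k = Σ (Fin k) λ i → Σ (Fin k) λ j → i F.< j

increasingPairs : ∀ k → List (IncreasingPair k)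
increasingPairs zero    = []
increasingPairs (suc k) =
  map (λ j → F.zero , F.suc j , s≤s z≤n) (allFin k) ++ map shift (increasingPairs k)
  where
  shift : IncreasingPair k → IncreasingPair (suc k)
  shift (i , j , i<j) = F.suc i , F.suc j , s≤s i<j

length-increasingPairs : ∀ k → length (increasingPairs k) ≡ k C 2
length-increasingPairs zero    = refl
length-increasingPairs (suc k) = begin
  length (map _ (allFin k) ++ map _ (increasingPairs k))           ≡⟨ length-++ (map _ (allFin k)) ⟩
  length (map _ (allFin k)) + length (map _ (increasingPairs k))   ≡⟨ cong₂ _+_ (length-map _ (allFin k))
                                                                                   (length-map _ (increasingPairs k)) ⟩
  length (allFin k) + length (increasingPairs k)                   ≡⟨ cong₂ _+_ (≡.trans (length-tabulate (λ i → i))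
                                                                                             (≡.sym (nC1≡n k)))
                                                                                   (length-increasingPairs k) ⟩
  k C 1 + k C 2                                                    ≡⟨ nCk+nC[k+1]≡[n+1]C[k+1] k 1 ⟩
  suc k C 2                                                        ∎
  where open ≡-Reasoning

∈-increasingPairs : ∀ {k} (i j : Fin k) (i<j : i F.< j) → (i , j , i<j) ∈ increasingPairs k
∈-increasingPairs {suc k} F.zero    (F.suc j) (s≤s z≤n) = ∈-++⁺ˡ (∈-map⁺ _ (∈-allFin j))
∈-increasingPairs {suc k} (F.suc i) (F.suc j) (s≤s i<j) =
  ∈-++⁺ʳ _ (∈-map⁺ _ (∈-increasingPairs i j i<j))

module _ {V : Set} {G : Graph V} where

  _++ᵂ_ : ∀ {x y z k m} → Walk G x y k → Walk G y z m → Walk G x z (k + m)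
  [ _ ]   ++ᵂ w = w
  (e ∷ u) ++ᵂ w = e ∷ (u ++ᵂ w)

  reverseᵂ : ∀ {x y k} → Walk G x y k → Walk G y x k
  reverseᵂ [ x ]                     = [ x ]
  reverseᵂ {k = suc k} (_∷_ {x} e w) =
    subst (Walk G _ x) (+-comm k 1) (reverseᵂ w ++ᵂ (Graph.sym G e ∷ [ x ]))

  splitᵂ : ∀ {v x y k} {w : Walk G x y k} → OnWalk v w →
           Σ ℕ λ k₁ → Σ ℕ λ k₂ → Walk G x v k₁ × Walk G v y k₂ × k₁ + k₂ ≡ k
  splitᵂ {v} here-nil        = 0 , 0 , [ v ] , [ v ] , refl
  splitᵂ {v} (here-cons e w) = 0 , _ , [ v ] , e ∷ w , refl
  splitᵂ (there e on) with splitᵂ on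
  ... | k₁ , k₂ , w₁ , w₂ , k₁+k₂≡k = suc k₁ , k₂ , e ∷ w₁ , w₂ , cong suc k₁+k₂≡k

mapᵂ : ∀ {A B : Set} {G : Graph A} {H : Graph B} (f : A → B) →
       (∀ {x y} → Adj G x y → Adj H (f x) (f y)) →
       ∀ {x y k} → Walk G x y k → Walk H (f x) (f y) k
mapᵂ f f-adj [ x ]   = [ f x ]
mapᵂ f f-adj (e ∷ w) = f-adj e ∷ mapᵂ f f-adj w

IsShortest : ∀ {V : Set} → Graph V → V → V → ℕ → Set
IsShortest G x y k = ∀ m → Walk G x y m → k ≤ m

shiftᵂ : ∀ {r} {p q : Fin r} {d} → Walk (PathGraph r) p q d → Walk (PathGraph (suc r)) (F.suc p) (F.suc q) d
shiftᵂ = mapᵂ F.suc (Sum.map (cong suc) (cong suc))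

pathWalk-from-0 : ∀ {r} (q : Fin (suc r)) → Walk (PathGraph (suc r)) F.zero q (toℕ q)
pathWalk-from-0 F.zero            = [ F.zero ]
pathWalk-from-0 {suc _} (F.suc q) = inj₁ refl ∷ shiftᵂ (pathWalk-from-0 q)

pathWalk : ∀ {r} (p q : Fin r) → Walk (PathGraph r) p q ∣ toℕ p - toℕ q ∣
pathWalk F.zero    q         = pathWalk-from-0 q
pathWalk (F.suc p) F.zero    = reverseᵂ (pathWalk-from-0 (F.suc p))
pathWalk (F.suc p) (F.suc q) = shiftᵂ (pathWalk p q)

∣-∣≡1-if-adjacent : ∀ {r} {p q : Fin r} → Adj (PathGraph r) p q → ∣ toℕ p - toℕ q ∣ ≡ 1
∣-∣≡1-if-adjacent {p = p} (inj₁ q≡1+p) rewrite q≡1+p = ∣n-1+n∣≡1 (toℕ p)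
∣-∣≡1-if-adjacent {q = q} (inj₂ p≡1+q) rewrite p≡1+q = ≡.trans (∣-∣-comm (suc (toℕ q)) (toℕ q)) (∣n-1+n∣≡1 (toℕ q))

-- A step of P_r □ G either stays in its layer {p} × V and moves in G (inj₁, a G-step),
-- or keeps the G-coordinate and moves to an adjacent layer (inj₂, a P-step).
module Layered {V : Set} (G : Graph V) (r : ℕ) where

  W : Fin r × V → Fin r × V → ℕ → Set
  W = Walk (PathGraph r □ G)

  layer : Fin r × V → ℕ
  layer = toℕ ∘ proj₁

  gSteps pSteps : ∀ {x y k} → W x y k → ℕ
  gSteps [ _ ]        = 0
  gSteps (inj₁ _ ∷ w) = suc (gSteps w)
  gSteps (inj₂ _ ∷ w) = gSteps w
  pSteps [ _ ]        = 0
  pSteps (inj₁ _ ∷ w) = pSteps w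
  pSteps (inj₂ _ ∷ w) = suc (pSteps w)

  gLayers : ∀ {x y k} → W x y k → List ℕ
  gLayers [ _ ]                = []
  gLayers (_∷_ {x} (inj₁ _) w) = layer x ∷ gLayers w
  gLayers (inj₂ _ ∷ w)         = gLayers w

  gSteps+pSteps≡length : ∀ {x y k} (w : W x y k) → gSteps w + pSteps w ≡ k
  gSteps+pSteps≡length [ _ ]        = refl
  gSteps+pSteps≡length (inj₁ _ ∷ w) = cong suc (gSteps+pSteps≡length w)
  gSteps+pSteps≡length (inj₂ _ ∷ w) = ≡.trans (+-suc (gSteps w) _) (cong suc (gSteps+pSteps≡length w))

  gSteps≤length : ∀ {x y k} (w : W x y k) → gSteps w ≤ k
  gSteps≤length w = ≤-trans (m≤m+n _ _) (≤-reflexive (gSteps+pSteps≡length w))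

  length-gLayers : ∀ {x y k} (w : W x y k) → length (gLayers w) ≡ gSteps w
  length-gLayers [ _ ]        = refl
  length-gLayers (inj₁ _ ∷ w) = cong suc (length-gLayers w)
  length-gLayers (inj₂ _ ∷ w) = length-gLayers w

  pSteps-++ : ∀ {x y z k m} (u : W x y k) (w : W y z m) → pSteps (u ++ᵂ w) ≡ pSteps u + pSteps w
  pSteps-++ [ _ ]        w = refl
  pSteps-++ (inj₁ _ ∷ u) w = pSteps-++ u w
  pSteps-++ (inj₂ _ ∷ u) w = cong suc (pSteps-++ u w)

  ∉-gLayers-tail : ∀ {l x y z k} (e : Adj (PathGraph r □ G) x y) (w : W y z k) →
                   l ∉ gLayers (e ∷ w) → l ∉ gLayers w
  ∉-gLayers-tail (inj₁ _) w l∉ = l∉ ∘ there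
  ∉-gLayers-tail (inj₂ _) w l∉ = l∉

  projectᵂ : ∀ {x y k} (w : W x y k) → Walk G (proj₂ x) (proj₂ y) (gSteps w)
  projectᵂ [ x ]                 = [ proj₂ x ]
  projectᵂ (inj₁ (_ , e) ∷ w)    = e ∷ projectᵂ w
  projectᵂ (inj₂ (refl , _) ∷ w) = projectᵂ w

  inLayer : (p : Fin r) → ∀ {g h k} → Walk G g h k → W (p , g) (p , h) k
  inLayer p = mapᵂ (p ,_) (λ e → inj₁ (refl , e))

  ∣-∣≤pSteps : ∀ {x y k} (w : W x y k) → ∣ layer x - layer y ∣ ≤ pSteps w
  ∣-∣≤pSteps {x} [ _ ]                = ≤-reflexive (∣n-n∣≡0 (layer x))
  ∣-∣≤pSteps (inj₁ (refl , _) ∷ w) = ∣-∣≤pSteps w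
  ∣-∣≤pSteps {x} {z} (_∷_ {y = y} (inj₂ (refl , e)) w) = begin
    ∣ layer x - layer z ∣                         ≤⟨ ∣-∣-triangle (layer x) (layer y) (layer z) ⟩
    ∣ layer x - layer y ∣ + ∣ layer y - layer z ∣ ≤⟨ +-mono-≤ (≤-reflexive (∣-∣≡1-if-adjacent e)) (∣-∣≤pSteps w) ⟩
    suc (pSteps w)                                ∎
    where open ≤-Reasoning

  detour : ∀ {p q g h m} → Walk G g h m → W (p , g) (q , h) (m + ∣ toℕ p - toℕ q ∣)
  detour {p} {q} {h = h} u = inLayer p u ++ᵂ mapᵂ (_, h) (λ e → inj₂ (refl , e)) (pathWalk p q)

  pSteps-shortest : ∀ {x y k} (w : W x y k) → IsShortest (PathGraph r □ G) x y k →
                    pSteps w ≤ ∣ layer x - layer y ∣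
  pSteps-shortest {x} {y} w shortest = +-cancelˡ-≤ (gSteps w) _ _ (begin
    gSteps w + pSteps w              ≡⟨ gSteps+pSteps≡length w ⟩
    _                                ≤⟨ shortest _ (detour (projectᵂ w)) ⟩
    gSteps w + ∣ layer x - layer y ∣ ∎)
    where open ≤-Reasoning

  projectᵂ-shortest : ∀ {x y k} (w : W x y k) → IsShortest (PathGraph r □ G) x y k →
                      IsShortest G (proj₂ x) (proj₂ y) (gSteps w)
  projectᵂ-shortest {x} {y} w shortest m u = +-cancelʳ-≤ (pSteps w) _ _ (begin
    gSteps w + pSteps w       ≡⟨ gSteps+pSteps≡length w ⟩
    _                         ≤⟨ shortest _ (detour u) ⟩
    m + ∣ layer x - layer y ∣ ≤⟨ +-monoʳ-≤ m (∣-∣≤pSteps w) ⟩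
    m + pSteps w              ∎)
    where open ≤-Reasoning

  visit⇒between : ∀ {x y k ℓ u} (w : W x y k) → IsShortest (PathGraph r □ G) x y k →
                  OnWalk (ℓ , u) w → ∣ layer x - toℕ ℓ ∣ + ∣ toℕ ℓ - layer y ∣ ≤ ∣ layer x - layer y ∣
  visit⇒between {x} {y} {ℓ = ℓ} w shortest on with splitᵂ on
  ... | k₁ , k₂ , w₁ , w₂ , k₁+k₂≡k = begin
    ∣ layer x - toℕ ℓ ∣ + ∣ toℕ ℓ - layer y ∣ ≤⟨ +-mono-≤ (∣-∣≤pSteps w₁) (∣-∣≤pSteps w₂) ⟩
    pSteps w₁ + pSteps w₂                     ≡⟨ pSteps-++ w₁ w₂ ⟨
    pSteps (w₁ ++ᵂ w₂)                        ≤⟨ pSteps-shortest (w₁ ++ᵂ w₂) shortest₁₂ ⟩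
    ∣ layer x - layer y ∣                     ∎
    where
    open ≤-Reasoning
    shortest₁₂ : IsShortest (PathGraph r □ G) x y (k₁ + k₂)
    shortest₁₂ = subst (IsShortest _ x y) (≡.sym k₁+k₂≡k) shortest

  -- Leaving layer ℓ by a P-step and coming back later can be replaced by moving inside ℓ.
  return-shortcut : ∀ {ℓ u v y z k} (e : Adj (PathGraph r □ G) (ℓ , u) y) (w : W y z k) →
                    toℕ ℓ ∉ gLayers (e ∷ w) → OnWalk (ℓ , v) w → Σ ℕ λ k′ → k′ < suc k × W (ℓ , u) z k′
  return-shortcut (inj₁ _) w ℓ∉ _ = ⊥-elim (ℓ∉ (here refl))
  return-shortcut {ℓ} (inj₂ e) w ℓ∉ on with splitᵂ on
  ... | k₁ , k₂ , w₁ , w₂ , k₁+k₂≡k =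
    gSteps w₁ + k₂ ,
    s≤s (≤-trans (+-monoˡ-≤ k₂ (gSteps≤length w₁)) (≤-reflexive k₁+k₂≡k)) ,
    inLayer ℓ (projectᵂ (inj₂ e ∷ w₁)) ++ᵂ w₂

  same-or-shortcut : ∀ {x y k ℓ u v} (w : W x y k) → toℕ ℓ ∉ gLayers w →
                     OnWalk (ℓ , u) w → OnWalk (ℓ , v) w → u ≡ v ⊎ Σ ℕ λ k′ → k′ < k × W x y k′
  same-or-shortcut _ ℓ∉ here-nil          here-nil           = inj₁ refl
  same-or-shortcut _ ℓ∉ (here-cons e w)   (here-cons .e .w)  = inj₁ refl
  same-or-shortcut _ ℓ∉ (here-cons e w)   (there .e on)      = inj₂ (return-shortcut e w ℓ∉ on)
  same-or-shortcut _ ℓ∉ (there e on)      (here-cons .e w)   = inj₂ (return-shortcut e w ℓ∉ on)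
  same-or-shortcut (e ∷ w) ℓ∉ (there .e on) (there .e on′)
    with same-or-shortcut w (∉-gLayers-tail e w ℓ∉) on on′
  ... | inj₁ u≡v              = inj₁ u≡v
  ... | inj₂ (k′ , k′<k , w′) = inj₂ (suc k′ , s≤s k′<k , e ∷ w′)

  visit-unique : ∀ {x y k ℓ u v} (w : W x y k) → IsShortest (PathGraph r □ G) x y k →
                 toℕ ℓ ∉ gLayers w → OnWalk (ℓ , u) w → OnWalk (ℓ , v) w → u ≡ v
  visit-unique w shortest ℓ∉ on on′ with same-or-shortcut w ℓ∉ on on′
  ... | inj₁ u≡v              = u≡v
  ... | inj₂ (k′ , k′<k , w′) = contradiction (shortest k′ w′) (<⇒≱ k′<k)

module StrongGeodeticLayers {n r : ℕ} {G : Graph (Fin n)} {Ω : List (Fin r × Fin n)}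
                            (sg : StrongGeodetic (PathGraph r □ G) Ω) where

  open Layered G r

  k : ℕ
  k = length Ω

  open Geodesic

  geodesic : (i j : Fin k) → i F.< j → Geodesic (PathGraph r □ G) (lookup Ω i) (lookup Ω j)
  geodesic = proj₁ sg

  gLayersOf : IncreasingPair k → List ℕ
  gLayersOf (i , j , i<j) = gLayers (walk (geodesic i j i<j))

  usedLayers : List ℕ
  usedLayers = map layer Ω ++ concatMap gLayersOf (increasingPairs k)

  length-usedLayers : ∀ {D} → (∀ x y d → Dist G x y d → d ≤ D) → length usedLayers ≤ k + D * (k C 2)
  length-usedLayers {D} diam≤D = begin
    length usedLayers
      ≡⟨ length-++ (map layer Ω) ⟩
    length (map layer Ω) + length (concatMap gLayersOf (increasingPairs k))
      ≤⟨ +-mono-≤ (≤-reflexive (length-map layer Ω)) (length-concatMap≤ gLayersOf gLayersOf≤D (increasingPairs k)) ⟩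
    k + D * length (increasingPairs k)
      ≡⟨ cong (λ m → k + D * m) (length-increasingPairs k) ⟩
    k + D * (k C 2)
      ∎
    where
    open ≤-Reasoning
    gLayersOf≤D : ∀ ijh → length (gLayersOf ijh) ≤ D
    gLayersOf≤D (i , j , i<j) = ≤-trans (≤-reflexive (length-gLayers (walk γ)))
      (diam≤D _ _ _ (projectᵂ (walk γ) , projectᵂ-shortest (walk γ) (shortest γ)))
      where
      γ : Geodesic (PathGraph r □ G) (lookup Ω i) (lookup Ω j)
      γ = geodesic i j i<j

  module _ (ℓ : Fin r) (ℓ∉ : toℕ ℓ ∉ usedLayers) where

    endpoint-layer≢ : ∀ i → layer (lookup Ω i) ≢ toℕ ℓ
    endpoint-layer≢ i eq = ℓ∉ (∈-++⁺ˡ (subst (_∈ map layer Ω) eq (∈-map⁺ layer (∈-lookup i))))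

    ∉-gLayers : ∀ i j i<j → toℕ ℓ ∉ gLayers (walk (geodesic i j i<j))
    ∉-gLayers i j i<j ℓ∈ =
      ℓ∉ (∈-++⁺ʳ _ (∈-concat⁺′ ℓ∈ (∈-map⁺ gLayersOf (∈-increasingPairs i j i<j))))

    Covers : Fin k → Fin k → Fin n → Set
    Covers i j v = Σ (i F.< j) λ i<j → OnWalk (ℓ , v) (walk (geodesic i j i<j))

    covers-unique : ∀ {i j v v′} → Covers i j v → Covers i j v′ → v ≡ v′
    covers-unique {i} {j} (i<j , on) (i<j′ , on′) rewrite FP.<-irrelevant i<j′ i<j =
      visit-unique (walk (geodesic i j i<j)) (shortest (geodesic i j i<j)) (∉-gLayers i j i<j) on on′

    Below : Fin k → Set
    Below i = layer (lookup Ω i) < toℕ ℓ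

    record Crossing (v : Fin n) : Set where
      field
        lo hi    : Fin k
        lo-below : Below lo
        hi-above : toℕ ℓ < layer (lookup Ω hi)
        covers   : Covers lo hi v ⊎ Covers hi lo v
    open Crossing

    crossing : ∀ v → Crossing v
    crossing v with proj₂ sg (ℓ , v)
    ... | i , j , i<j , on
      with ∣-∣-strictly-between (endpoint-layer≢ i) (endpoint-layer≢ j)
             (visit⇒between (walk (geodesic i j i<j)) (shortest (geodesic i j i<j)) on)
    ... | inj₁ (i-below , j-above) = record { lo = i ; hi = j ; lo-below = i-below ; hi-above = j-above
                                            ; covers = inj₁ (i<j , on) }
    ... | inj₂ (j-below , i-above) = record { lo = j ; hi = i ; lo-below = j-below ; hi-above = i-above
                                            ; covers = inj₂ (i<j , on) }

    endpoints : Fin n → Fin k × Fin k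
    endpoints v = lo (crossing v) , hi (crossing v)

    covers-either-unique : ∀ {i j v v′} → Covers i j v ⊎ Covers j i v → Covers i j v′ ⊎ Covers j i v′ → v ≡ v′
    covers-either-unique (inj₁ c)         (inj₁ c′)         = covers-unique c c′
    covers-either-unique (inj₂ c)         (inj₂ c′)         = covers-unique c c′
    covers-either-unique (inj₁ (i<j , _)) (inj₂ (j<i , _)) = contradiction i<j (<⇒≯ j<i)
    covers-either-unique (inj₂ (j<i , _)) (inj₁ (i<j , _)) = contradiction i<j (<⇒≯ j<i)

    endpoints-injective : Injective _≡_ _≡_ endpoints
    endpoints-injective {v} {v′} eq = covers-either-unique (covers (crossing v))
      (subst₂ (λ i j → Covers i j v′ ⊎ Covers j i v′) (≡.sym lo≡) (≡.sym hi≡) (covers (crossing v′)))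
      where
      lo≡ : lo (crossing v) ≡ lo (crossing v′)
      lo≡ = proj₁ (,-injective eq)
      hi≡ : hi (crossing v) ≡ hi (crossing v′)
      hi≡ = proj₂ (,-injective eq)

    4*n≤k*k : 4 * n ≤ k * k
    4*n≤k*k = 4*≤-square-if-injective-across (λ i → layer (lookup Ω i) <? toℕ ℓ) endpoints
      (λ v → lo-below (crossing v) , <⇒≯ (hi-above (crossing v))) endpoints-injective

theorem2p4 : (n : ℕ) (G : Graph (Fin n)) → Connected G →
    (r : ℕ) → 1 ≤ r →
    (D : ℕ) → IsDiam G D →
    (Ω : List (Fin r × Fin n)) → MinStrongGeodetic (PathGraph r □ G) Ω →
    D * (length Ω C 2) + length Ω < r →
    (c : ℕ) → IsCeil2Sqrt n c → c ≤ length Ω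
theorem2p4 n G _ r _ D (diam≤D , _) Ω (_ , sg , _) D*C+k<r c (_ , c-least) =
  c-least (length Ω) (uncurry 4*n≤k*k (∃-toℕ∉ usedLayers |usedLayers|<r))
  where
  open StrongGeodeticLayers {Ω = Ω} sg
  |usedLayers|<r : length usedLayers < r
  |usedLayers|<r = ≤-<-trans (length-usedLayers diam≤D) (≤-<-trans (≤-reflexive (+-comm k _)) D*C+k<r)
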